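{- With the notation below, we have the identities \begin{align*} a_1 a_2 a_3 v &= b^2 v^2 + C^2 d, \\ A_1 A_2 A_3 &= N^2 - a_6 C^2, \\ a_2 a_3 C_1^2 + a_1 a_3 C_2^2 + a_1 a_2 C_3^2 &= -2Mbv + C^2 (3u^2 + a_4 v^2), \\ A_2 A_3 C_1^2 + A_1 A_3 C_2^2 + A_1 A_2 C_3^2 &= -2MN + a_4 C^2, \\ a_1 C_2^2 C_3^2 + a_2 C_1^2 C_3^2 + a_3 C_1^2 C_2^2 &= M^2 v + 3C^2 u, \\ A_1 C_2^2 C_3^2 + A_2 C_1^2 C_3^2 + A_3 C_1^2 C_2^2 &= M^2. \end{align*} Furthermore, for distinct indices $i,j,k \in \{1,2,3\}$, we have the divisibility conditions \begin{align*} C_i C_j &\mid MN + A_i A_j C_k^2, \\ C_i C_j &\mid A_i A_j M + A_i C_j^2 N + A_j C_i^2 N. \end{align*}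
   Context: Let $E: y^2 = x^3 + a_4 x + a_6$ be an elliptic curve with $a_4, a_6 \in \mathbb{Z}$. For $u,v\in\mathbb{Z}$ set $d_E(u,v) := v(u^3 + a_4 u v^2 - a_6 v^3)$ and $D_E(u,v) := 4 d_E(u,v)$. Fix a pair $(u,v)\in\mathbb{Z}^2$ such that $u$, $v$, $3u^2 + a_4 v^2$ and $D_E(u,v)$ are all positive, and such that $-D_E(u,v)$ is a negative fundamental discriminant; write $d := d_E(u,v)$. Consider three finite points $P_i = \big(\frac{A_i}{C_i^2}, \frac{B_i}{C_i^3}\big) \in E(\mathbb{Q})$ ($i=1,2,3$), with $A_i,B_i,C_i\in\mathbb{Z}$, $\gcd(A_i,C_i) = \gcd(B_i,C_i) = 1$ and $C_i > 0$, satisfying $P_1 + P_2 + P_3 = \mathcal{O}$. Let $l\,y = m\,x + n$ with $l, m, n \in \mathbb{Z}$ be the line whose intersections with $E$ are precisely the points $P_1,P_2,P_3$, counting multiplicities. Set $C := C_1 C_2 C_3$, $M := C\cdot\frac{m}{l}$, $N := C\cdot\frac{n}{l}$, $b := Nv - Mu$, and $a_i := A_i v + C_i^2 u$. -}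

module Defs where

open import Data.Nat using (ℕ)
open import Data.Integer as ℤ using (ℤ; +_)
open import Data.Rational as ℚ using (ℚ; 0ℚ; 1/_; ≢-nonZero)
open import Data.Product using (Σ; ∃; _×_)
open import Data.Integer.Divisibility using (_∣_)
open import Data.Sum using (_⊎_)
open import Relation.Binary.PropositionalEquality using (_≡_; _≢_)
open import Relation.Nullary using (yes; no)

↑ : ℤ → ℚ
↑ z = z ℚ./ 1

-- total inverse on ℚ (1/0 := 0); only ever applied to nonzero arguments below
inv : ℚ → ℚ
inv q with q ℚ.≟ 0ℚ
... | yes _ = 0ℚ
... | no q≢0 = (1/ q) {{≢-nonZero q≢0}}

Nonsingular : ℤ → ℤ → Set
Nonsingular a4 a6 = (+ 4) ℤ.* a4 ℤ.* a4 ℤ.* a4 ℤ.+ (+ 27) ℤ.* a6 ℤ.* a6 ≢ + 0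

OnCurve : ℤ → ℤ → ℚ → ℚ → Set
OnCurve a4 a6 x y = y ℚ.* y ≡ x ℚ.* x ℚ.* x ℚ.+ ↑ a4 ℚ.* x ℚ.+ ↑ a6

data Pt : Set where
  O  : Pt
  pt : ℚ → ℚ → Pt

addE : ℤ → Pt → Pt → Pt
addE a4 O Q = Q
addE a4 (pt x₁ y₁) O = pt x₁ y₁
addE a4 (pt x₁ y₁) (pt x₂ y₂) with x₁ ℚ.≟ x₂
... | no _ =
  let λ' = (y₂ ℚ.- y₁) ℚ.* inv (x₂ ℚ.- x₁)
      x₃ = λ' ℚ.* λ' ℚ.- x₁ ℚ.- x₂
  in pt x₃ (λ' ℚ.* (x₁ ℚ.- x₃) ℚ.- y₁)
... | yes _ with y₁ ℚ.+ y₂ ℚ.≟ 0ℚ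
...   | yes _ = O
...   | no _ =
  let λ' = (↑ (+ 3) ℚ.* x₁ ℚ.* x₁ ℚ.+ ↑ a4) ℚ.* inv (↑ (+ 2) ℚ.* y₁)
      x₃ = λ' ℚ.* λ' ℚ.- x₁ ℚ.- x₂
  in pt x₃ (λ' ℚ.* (x₁ ℚ.- x₃) ℚ.- y₁)

-- squarefree integer: no square k² with k ≠ 1 divides it (so 0 is not squarefree)
SquareFree : ℤ → Set
SquareFree m = ∀ (k : ℕ) → (+ k) ℤ.* (+ k) ∣ m → k ≡ 1

FundamentalDiscriminant : ℤ → Set
FundamentalDiscriminant D =
  (D ≢ + 1 × (∃ λ t → D ≡ (+ 4) ℤ.* t ℤ.+ + 1) × SquareFree D)
  ⊎ (∃ λ m → D ≡ (+ 4) ℤ.* m × ((∃ λ t → m ≡ (+ 4) ℤ.* t ℤ.+ + 2) ⊎ (∃ λ t → m ≡ (+ 4) ℤ.* t ℤ.+ + 3)) × SquareFree m)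

_∣ℚ_ : ℤ → ℚ → Set
k ∣ℚ X = ∃ λ (t : ℤ) → X ≡ ↑ (k ℤ.* t)

dE : ℤ → ℤ → ℤ → ℤ → ℤ
dE a4 a6 u v = v ℤ.* (u ℤ.* u ℤ.* u ℤ.+ a4 ℤ.* u ℤ.* v ℤ.* v ℤ.- a6 ℤ.* v ℤ.* v ℤ.* v)

DE : ℤ → ℤ → ℤ → ℤ → ℤ
DE a4 a6 u v = (+ 4) ℤ.* dE a4 a6 u v

{-# OPTIONS --safe #-}
module Submission where

-- Removing the line l y = m x + n from the curve leaves the cubic whose roots are the
-- abscissae xᵢ = Aᵢ/Cᵢ², so the Vieta formulas (for any ordering of the three points),
-- multiplied by C², are the second, fourth and sixth identities. The sixth and second say
-- that M² and N² are integers, hence so are M and N. The first, third and fifth identities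
-- are polynomial consequences of these once aᵢ = Aᵢ v + Cᵢ² u is substituted. For the
-- divisibilities, Pₖ lying on the line gives M Aₖ + N Cₖ² = Cᵢ Cⱼ Bₖ; with the Vieta
-- relations this shows that Cᵢ Cⱼ divides Aₖ X and Cₖ² X for each quantity X in question,
-- and gcd(Aₖ, Cₖ) = 1 then gives Cᵢ Cⱼ ∣ X.

open import Defs
open import Data.Fin using (Fin; #_)
open import Data.Integer as ℤ using (ℤ; +_)
open import Data.Integer.GCD using (gcd)
open import Data.Rational as ℚ using (ℚ)
open import Data.Product using (_×_)
open import Relation.Binary.PropositionalEquality using (_≡_; _≢_)

open import Algebra.Bundles using (CommutativeSemigroup; CommutativeMonoid)
import Algebra.Properties.CommutativeSemigroup as CommutativeSemigroupProperties
open import Data.Empty using (⊥-elim)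
open import Data.Sum using ([_,_]′)
open import Data.Fin.Patterns using (0F; 1F; 2F)
open import Data.List using (_∷_; [])
open import Data.Nat as ℕ using (suc)
import Data.Nat.Coprimality as ℕ
import Data.Nat.Divisibility as ℕ
import Data.Nat.Properties as ℕ
open import Data.Product using (_,_; proj₁; proj₂)
open import Data.Integer.Coprimality using (Coprime)
open import Data.Integer.Divisibility.Signed using (_∣_; divides; ∣ᵤ⇒∣; ∣⇒∣ᵤ; ∣n⇒∣m*n)
import Data.Integer.Properties as ℤ
open import Data.Integer.Tactic.RingSolver using (solve; solve-∀)
import Data.Rational.Properties as ℚ
open import Algebra.Properties.Group ℚ.+-0-group using (x∙y⁻¹≈ε⇒x≈y)
open import Data.Rational.Unnormalised as ℚᵘ using (mkℚᵘ; *≡*)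
import Data.Rational.Unnormalised.Properties as ℚᵘ
open import Level using (0ℓ)
open import Relation.Nullary.Decidable using (dec⇒maybe; yes; no)
open import Relation.Binary.PropositionalEquality
  using (refl; sym; trans; cong; cong₂; subst; ≢-sym; module ≡-Reasoning)
import Tactic.RingSolver as RingSolver
open import Tactic.RingSolver.Core.AlmostCommutativeRing
  using (AlmostCommutativeRing; fromCommutativeRing)

ℚ-ring : AlmostCommutativeRing 0ℓ 0ℓ
ℚ-ring = fromCommutativeRing ℚ.+-*-commutativeRing (λ q → dec⇒maybe (ℚ.0ℚ ℚ.≟ q))

fromℚᵘ-homo-+ : ∀ p q → ℚ.fromℚᵘ (p ℚᵘ.+ q) ≡ ℚ.fromℚᵘ p ℚ.+ ℚ.fromℚᵘ q
fromℚᵘ-homo-+ p q = ℚ.toℚᵘ-injective (begin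
  ℚ.toℚᵘ (ℚ.fromℚᵘ (p ℚᵘ.+ q))                    ≈⟨ ℚ.toℚᵘ-fromℚᵘ (p ℚᵘ.+ q) ⟩
  p ℚᵘ.+ q                                         ≈⟨ ℚᵘ.+-cong (ℚ.toℚᵘ-fromℚᵘ p) (ℚ.toℚᵘ-fromℚᵘ q) ⟨
  ℚ.toℚᵘ (ℚ.fromℚᵘ p) ℚᵘ.+ ℚ.toℚᵘ (ℚ.fromℚᵘ q)    ≈⟨ ℚ.toℚᵘ-homo-+ (ℚ.fromℚᵘ p) (ℚ.fromℚᵘ q) ⟨
  ℚ.toℚᵘ (ℚ.fromℚᵘ p ℚ.+ ℚ.fromℚᵘ q)              ∎)
  where open ℚᵘ.≃-Reasoning

fromℚᵘ-homo-* : ∀ p q → ℚ.fromℚᵘ (p ℚᵘ.* q) ≡ ℚ.fromℚᵘ p ℚ.* ℚ.fromℚᵘ q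
fromℚᵘ-homo-* p q = ℚ.toℚᵘ-injective (begin
  ℚ.toℚᵘ (ℚ.fromℚᵘ (p ℚᵘ.* q))                    ≈⟨ ℚ.toℚᵘ-fromℚᵘ (p ℚᵘ.* q) ⟩
  p ℚᵘ.* q                                         ≈⟨ ℚᵘ.*-cong (ℚ.toℚᵘ-fromℚᵘ p) (ℚ.toℚᵘ-fromℚᵘ q) ⟨
  ℚ.toℚᵘ (ℚ.fromℚᵘ p) ℚᵘ.* ℚ.toℚᵘ (ℚ.fromℚᵘ q)    ≈⟨ ℚ.toℚᵘ-homo-* (ℚ.fromℚᵘ p) (ℚ.fromℚᵘ q) ⟨
  ℚ.toℚᵘ (ℚ.fromℚᵘ p ℚ.* ℚ.fromℚᵘ q)              ∎)
  where open ℚᵘ.≃-Reasoning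

fromℚᵘ-homo‿- : ∀ p → ℚ.fromℚᵘ (ℚᵘ.- p) ≡ ℚ.- ℚ.fromℚᵘ p
fromℚᵘ-homo‿- p = ℚ.toℚᵘ-injective (begin
  ℚ.toℚᵘ (ℚ.fromℚᵘ (ℚᵘ.- p))      ≈⟨ ℚ.toℚᵘ-fromℚᵘ (ℚᵘ.- p) ⟩
  ℚᵘ.- p                          ≈⟨ ℚᵘ.-‿cong (ℚ.toℚᵘ-fromℚᵘ p) ⟨
  ℚᵘ.- ℚ.toℚᵘ (ℚ.fromℚᵘ p)        ≈⟨ ℚ.toℚᵘ-homo‿- (ℚ.fromℚᵘ p) ⟨
  ℚ.toℚᵘ (ℚ.- ℚ.fromℚᵘ p)         ∎)
  where open ℚᵘ.≃-Reasoning

-- ↑ z is definitionally ℚ.fromℚᵘ (mkℚᵘ z 0).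
↑-+ : ∀ x y → ↑ (x ℤ.+ y) ≡ ↑ x ℚ.+ ↑ y
↑-+ x y = trans (ℚ.fromℚᵘ-cong {mkℚᵘ (x ℤ.+ y) 0} {mkℚᵘ x 0 ℚᵘ.+ mkℚᵘ y 0} (*≡* x+y≡x*1+y*1))
                (fromℚᵘ-homo-+ (mkℚᵘ x 0) (mkℚᵘ y 0))
  where
  x+y≡x*1+y*1 : (x ℤ.+ y) ℤ.* + 1 ≡ (x ℤ.* + 1 ℤ.+ y ℤ.* + 1) ℤ.* + 1
  x+y≡x*1+y*1 = cong (ℤ._* + 1) (sym (cong₂ ℤ._+_ (ℤ.*-identityʳ x) (ℤ.*-identityʳ y)))

↑-* : ∀ x y → ↑ (x ℤ.* y) ≡ ↑ x ℚ.* ↑ y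
↑-* x y = fromℚᵘ-homo-* (mkℚᵘ x 0) (mkℚᵘ y 0)

↑-neg : ∀ x → ↑ (ℤ.- x) ≡ ℚ.- ↑ x
↑-neg x = fromℚᵘ-homo‿- (mkℚᵘ x 0)

↑-injective : ∀ {x y} → ↑ x ≡ ↑ y → x ≡ y
↑-injective {x} {y} ↑x≡↑y with ℚ.fromℚᵘ-injective {mkℚᵘ x 0} {mkℚᵘ y 0} ↑x≡↑y
... | *≡* x*1≡y*1 = ℤ.*-cancelʳ-≡ x y (+ 1) x*1≡y*1

-- The operations below compute the value by the same
-- expression over ℤ, so a witness assembled from integral has as its value, definitionally,
-- the integer counterpart of the rational expression.
↑-≢0 : ∀ {z} → z ≢ + 0 → ↑ z ≢ ℚ.0ℚ
↑-≢0 z≢0 ↑z≡0 = z≢0 (↑-injective ↑z≡0)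

record Integral (q : ℚ) : Set where
  field
    value  : ℤ
    ↑value : ↑ value ≡ q

open Integral

integral : ∀ z → Integral (↑ z)
integral z = record { value = z ; ↑value = refl }

infixl 6 _⊕_ _⊖_
infixl 7 _⊛_
infix  8 ⊝_

_⊕_ : ∀ {p q} → Integral p → Integral q → Integral (p ℚ.+ q)
P ⊕ Q = record { value = value P ℤ.+ value Q
               ; ↑value = trans (↑-+ (value P) (value Q)) (cong₂ ℚ._+_ (↑value P) (↑value Q)) }

_⊛_ : ∀ {p q} → Integral p → Integral q → Integral (p ℚ.* q)
P ⊛ Q = record { value = value P ℤ.* value Q
               ; ↑value = trans (↑-* (value P) (value Q)) (cong₂ ℚ._*_ (↑value P) (↑value Q)) }

⊝_ : ∀ {q} → Integral q → Integral (ℚ.- q)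
⊝ Q = record { value = ℤ.- value Q ; ↑value = trans (↑-neg (value Q)) (cong ℚ.-_ (↑value Q)) }

_⊖_ : ∀ {p q} → Integral p → Integral q → Integral (p ℚ.- q)
P ⊖ Q = P ⊕ ⊝ Q

value-≡⇒≡ : ∀ {p q} (P : Integral p) (Q : Integral q) → value P ≡ value Q → p ≡ q
value-≡⇒≡ P Q eq = trans (sym (↑value P)) (trans (cong ↑ eq) (↑value Q))

≡⇒value-≡ : ∀ {p q} (P : Integral p) (Q : Integral q) → p ≡ q → value P ≡ value Q
≡⇒value-≡ P Q eq = ↑-injective (trans (↑value P) (trans eq (sym (↑value Q))))

∣value⇒∣ℚ : ∀ {k q} (Q : Integral q) → k ∣ value Q → k ∣ℚ q
∣value⇒∣ℚ {k} Q (divides t value≡t*k) =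
  t , trans (sym (↑value Q)) (cong ↑ (trans value≡t*k (ℤ.*-comm t k)))

-- If q = n/d with q² = z integral, then d ∣ n² and d is coprime to n, hence d = 1.
square-integral⇒integral : ∀ {q r} → Integral r → q ℚ.* q ≡ r → Integral q
square-integral⇒integral {q@(ℚ.mkℚ n d-1 n⊥d)} Z q²≡r = record
  { value = n
  ; ↑value = trans (cong (λ e → ℚ.fromℚᵘ (mkℚᵘ n e)) (sym d-1≡0)) (ℚ.fromℚᵘ-toℚᵘ q) }
  where
  d = suc d-1
  z = value Z
  q²≡z : q ℚ.* q ≡ ↑ z
  q²≡z = trans q²≡r (sym (↑value Z))
  n²≡zd² : (n ℤ.* n) ℤ.* + 1 ≡ z ℤ.* + (d ℕ.* d)
  n²≡zd² with ℚᵘ.≃-trans (ℚᵘ.≃-sym (ℚ.toℚᵘ-homo-* q q))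
                (ℚᵘ.≃-trans (ℚ.toℚᵘ-cong q²≡z) (ℚ.toℚᵘ-fromℚᵘ (mkℚᵘ z 0)))
  ... | *≡* eq = eq
  ∣n∣²≡∣z∣d² : ℤ.∣ n ∣ ℕ.* ℤ.∣ n ∣ ≡ ℤ.∣ z ∣ ℕ.* d ℕ.* d
  ∣n∣²≡∣z∣d² = begin
    ℤ.∣ n ∣ ℕ.* ℤ.∣ n ∣          ≡⟨ ℤ.abs-* n n ⟨
    ℤ.∣ n ℤ.* n ∣               ≡⟨ cong ℤ.∣_∣ (ℤ.*-identityʳ (n ℤ.* n)) ⟨
    ℤ.∣ (n ℤ.* n) ℤ.* + 1 ∣     ≡⟨ cong ℤ.∣_∣ n²≡zd² ⟩
    ℤ.∣ z ℤ.* + (d ℕ.* d) ∣     ≡⟨ ℤ.abs-* z (+ (d ℕ.* d)) ⟩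
    ℤ.∣ z ∣ ℕ.* (d ℕ.* d)       ≡⟨ ℕ.*-assoc ℤ.∣ z ∣ d d ⟨
    ℤ.∣ z ∣ ℕ.* d ℕ.* d         ∎
    where open ≡-Reasoning
  d∣∣n∣ : d ℕ.∣ ℤ.∣ n ∣
  d∣∣n∣ = ℕ.coprime-divisor (ℕ.sym (ℕ.recompute n⊥d)) (ℕ.divides (ℤ.∣ z ∣ ℕ.* d) ∣n∣²≡∣z∣d²)
  d-1≡0 : d-1 ≡ 0
  d-1≡0 = ℕ.suc-injective (ℕ.recompute n⊥d (d∣∣n∣ , ℕ.∣-refl))

inv-inverseˡ : ∀ {q} → q ≢ ℚ.0ℚ → inv q ℚ.* q ≡ ℚ.1ℚ
inv-inverseˡ {q} q≢0 with q ℚ.≟ ℚ.0ℚ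
... | yes q≡0 = ⊥-elim (q≢0 q≡0)
... | no  _    = ℚ.*-inverseˡ q {{ℚ.≢-nonZero q≢0}}

inv-cancelʳ : ∀ {p q} → q ≢ ℚ.0ℚ → p ℚ.* inv q ℚ.* q ≡ p
inv-cancelʳ {p} {q} q≢0 = begin
  p ℚ.* inv q ℚ.* q      ≡⟨ ℚ.*-assoc p (inv q) q ⟩
  p ℚ.* (inv q ℚ.* q)    ≡⟨ cong (p ℚ.*_) (inv-inverseˡ q≢0) ⟩
  p ℚ.* ℚ.1ℚ             ≡⟨ ℚ.*-identityʳ p ⟩
  p                      ∎
  where open ≡-Reasoning

module _ {c ℓ} (S : CommutativeSemigroup c ℓ) where
  open CommutativeSemigroup S using (Carrier; _∙_; _≈_) renaming (refl to ≈-refl)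
  open CommutativeSemigroupProperties S

  ∙-distinct-triple : ∀ (f : Fin 3 → Carrier) i j k → i ≢ j → j ≢ k → i ≢ k →
                      f i ∙ f j ∙ f k ≈ f 0F ∙ f 1F ∙ f 2F
  ∙-distinct-triple f 0F 0F _  i≢j _   _   = ⊥-elim (i≢j refl)
  ∙-distinct-triple f 1F 1F _  i≢j _   _   = ⊥-elim (i≢j refl)
  ∙-distinct-triple f 2F 2F _  i≢j _   _   = ⊥-elim (i≢j refl)
  ∙-distinct-triple f _  0F 0F _   j≢k _   = ⊥-elim (j≢k refl)
  ∙-distinct-triple f _  1F 1F _   j≢k _   = ⊥-elim (j≢k refl)
  ∙-distinct-triple f _  2F 2F _   j≢k _   = ⊥-elim (j≢k refl)
  ∙-distinct-triple f 0F _  0F _   _   i≢k = ⊥-elim (i≢k refl)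
  ∙-distinct-triple f 1F _  1F _   _   i≢k = ⊥-elim (i≢k refl)
  ∙-distinct-triple f 2F _  2F _   _   i≢k = ⊥-elim (i≢k refl)
  ∙-distinct-triple f 0F 1F 2F _   _   _   = ≈-refl
  ∙-distinct-triple f 0F 2F 1F _   _   _   = xy∙z≈xz∙y (f 0F) (f 2F) (f 1F)
  ∙-distinct-triple f 1F 0F 2F _   _   _   = xy∙z≈yx∙z (f 1F) (f 0F) (f 2F)
  ∙-distinct-triple f 1F 2F 0F _   _   _   = xy∙z≈zx∙y (f 1F) (f 2F) (f 0F)
  ∙-distinct-triple f 2F 0F 1F _   _   _   = xy∙z≈yz∙x (f 2F) (f 0F) (f 1F)
  ∙-distinct-triple f 2F 1F 0F _   _   _   = xy∙z≈zy∙x (f 2F) (f 1F) (f 0F)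

-- A proof of x ≡ y by exhibiting x - y as a combination of differences of
-- hypotheses: linear-combination (k₁ ·ₕ h₁ +ₕ k₂ ·ₕ h₂) p needs only the ring
-- identity p : x ≡ y + (k₁ (l₁ - r₁) + k₂ (l₂ - r₂)) for hᵢ : lᵢ ≡ rᵢ.
module ℚ-LinearCombination where
  open import Data.Rational using (_+_; _*_; _-_; 0ℚ)

  infixl 6 _+ₕ_
  infix  7 _·ₕ_

  _·ₕ_ : ∀ k {x y} → x ≡ y → k * (x - y) ≡ 0ℚ
  _·ₕ_ k {x} refl = trans (cong (k *_) (ℚ.+-inverseʳ x)) (ℚ.*-zeroʳ k)

  _+ₕ_ : ∀ {d e} → d ≡ 0ℚ → e ≡ 0ℚ → d + e ≡ 0ℚ
  refl +ₕ refl = refl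

  linear-combination : ∀ {x y d} → d ≡ 0ℚ → x ≡ y + d → x ≡ y
  linear-combination {y = y} refl x≡y+0 = trans x≡y+0 (ℚ.+-identityʳ y)

module ℤ-LinearCombination where
  open import Data.Integer using (_+_; _*_; _-_; 0ℤ)

  infixl 6 _+ₕ_
  infix  7 _·ₕ_

  _·ₕ_ : ∀ k {x y} → x ≡ y → k * (x - y) ≡ 0ℤ
  _·ₕ_ k {x} refl = trans (cong (k *_) (ℤ.+-inverseʳ x)) (ℤ.*-zeroʳ k)

  _+ₕ_ : ∀ {d e} → d ≡ 0ℤ → e ≡ 0ℤ → d + e ≡ 0ℤ
  refl +ₕ refl = refl

  linear-combination : ∀ {x y d} → d ≡ 0ℤ → x ≡ y + d → x ≡ y
  linear-combination {y = y} refl x≡y+0 = trans x≡y+0 (ℤ.+-identityʳ y)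

module _ where
  open import Data.Rational using (_+_; _*_; _-_; -_; ½; 0ℚ; 1ℚ)
  open ℚ-LinearCombination

  double-injective : ∀ {p q} → p + p ≡ q + q → p ≡ q
  double-injective {p} {q} p+p≡q+q = begin
    p            ≡⟨ RingSolver.solve (p ∷ []) ℚ-ring ⟩
    ½ * (p + p)  ≡⟨ cong (½ *_) p+p≡q+q ⟩
    ½ * (q + q)  ≡⟨ RingSolver.solve (q ∷ []) ℚ-ring ⟩
    q            ∎
    where open ≡-Reasoning

  x-y≡0⇒x≡y : ∀ {x y} → x - y ≡ 0ℚ → x ≡ y
  x-y≡0⇒x≡y = x∙y⁻¹≈ε⇒x≈y _ _

  x≡y-z⇒y≡x+z : ∀ {x} y z → x ≡ y - z → y ≡ x + z
  x≡y-z⇒y≡x+z {x} y z x≡y-z = linear-combination ((- 1ℚ) ·ₕ x≡y-z) (RingSolver.solve (x ∷ y ∷ z ∷ []) ℚ-ring)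

  quadratic-vanishing : ∀ {a b c} → (∀ X → a * X * X + b * X + c ≡ 0ℚ) →
                        a ≡ 0ℚ × b ≡ 0ℚ × c ≡ 0ℚ
  quadratic-vanishing {a} {b} {c} f≡0 = a≡0 , b≡0 , c≡0
    where
    open ≡-Reasoning
    c≡0 : c ≡ 0ℚ
    c≡0 = begin
      c                            ≡⟨ RingSolver.solve (a ∷ b ∷ c ∷ []) ℚ-ring ⟩
      a * 0ℚ * 0ℚ + b * 0ℚ + c     ≡⟨ f≡0 0ℚ ⟩
      0ℚ                           ∎
    a≡0 : a ≡ 0ℚ
    a≡0 = double-injective (begin
      a + a                                              ≡⟨ RingSolver.solve (a ∷ b ∷ c ∷ []) ℚ-ring ⟩
      (a * 1ℚ * 1ℚ + b * 1ℚ + c) + (a * - 1ℚ * - 1ℚ + b * - 1ℚ + c) - (c + c)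
                                                         ≡⟨ cong₂ (λ s t → s + t - (c + c)) (f≡0 1ℚ) (f≡0 (- 1ℚ)) ⟩
      0ℚ + 0ℚ - (c + c)                                  ≡⟨ cong (λ t → 0ℚ + 0ℚ - (t + t)) c≡0 ⟩
      0ℚ + 0ℚ                                            ∎)
    b≡0 : b ≡ 0ℚ
    b≡0 = double-injective (begin
      b + b                                              ≡⟨ RingSolver.solve (a ∷ b ∷ c ∷ []) ℚ-ring ⟩
      (a * 1ℚ * 1ℚ + b * 1ℚ + c) - (a * - 1ℚ * - 1ℚ + b * - 1ℚ + c)
                                                         ≡⟨ cong₂ _-_ (f≡0 1ℚ) (f≡0 (- 1ℚ)) ⟩
      0ℚ + 0ℚ                                            ∎)

  vieta : ∀ L il m n a₄ a₆ x₀ x₁ x₂ → L * il ≡ 1ℚ →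
          (∀ X → L * L * (X * X * X + a₄ * X + a₆) - (m * X + n) * (m * X + n)
                 ≡ L * L * ((X - x₀) * (X - x₁) * (X - x₂))) →
          (x₀ + x₁ + x₂ ≡ (m * il) * (m * il))
          × (x₀ * x₁ + x₀ * x₂ + x₁ * x₂ ≡ a₄ - (1ℚ + 1ℚ) * (m * il) * (n * il))
          × (x₀ * x₁ * x₂ ≡ (n * il) * (n * il) - a₆)
  vieta L il m n a₄ a₆ x₀ x₁ x₂ L·il≡1 poly =
    let e₁ , e₂ , e₃ = coefficients in x-y≡0⇒x≡y e₁ , sym (x-y≡0⇒x≡y e₂) , x-y≡0⇒x≡y e₃
    where
    difference : ∀ X →
      (x₀ + x₁ + x₂ - (m * il) * (m * il)) * X * X
        + (a₄ - (1ℚ + 1ℚ) * (m * il) * (n * il) - (x₀ * x₁ + x₀ * x₂ + x₁ * x₂)) * X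
        + (x₀ * x₁ * x₂ - ((n * il) * (n * il) - a₆))
      ≡ 0ℚ
    difference X = linear-combination
      ((il * il) ·ₕ poly X
        +ₕ (- ((L * il + 1ℚ) * (X * X * X + a₄ * X + a₆ - (X - x₀) * (X - x₁) * (X - x₂)))) ·ₕ L·il≡1)
      (RingSolver.solve (L ∷ il ∷ m ∷ n ∷ a₄ ∷ a₆ ∷ x₀ ∷ x₁ ∷ x₂ ∷ X ∷ []) ℚ-ring)
    coefficients : (x₀ + x₁ + x₂ - (m * il) * (m * il) ≡ 0ℚ)
                   × (a₄ - (1ℚ + 1ℚ) * (m * il) * (n * il) - (x₀ * x₁ + x₀ * x₂ + x₁ * x₂) ≡ 0ℚ)
                   × (x₀ * x₁ * x₂ - ((n * il) * (n * il) - a₆) ≡ 0ℚ)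
    coefficients = quadratic-vanishing difference

  module ScaledVieta {c₀ c₁ c₂ γ : ℚ} (c₀c₁c₂≡γ² : c₀ * c₁ * c₂ ≡ γ * γ) where

    scaled-e₁ : ∀ x₀ x₁ x₂ μ {A₀ A₁ A₂} → A₀ ≡ x₀ * c₀ → A₁ ≡ x₁ * c₁ → A₂ ≡ x₂ * c₂ →
                x₀ + x₁ + x₂ ≡ μ * μ →
                A₀ * c₁ * c₂ + A₁ * c₀ * c₂ + A₂ * c₀ * c₁ ≡ (γ * μ) * (γ * μ)
    scaled-e₁ x₀ x₁ x₂ μ refl refl refl e₁ = linear-combination
      ((c₀ * c₁ * c₂) ·ₕ e₁ +ₕ (μ * μ) ·ₕ c₀c₁c₂≡γ²)
      (RingSolver.solve (c₀ ∷ c₁ ∷ c₂ ∷ γ ∷ x₀ ∷ x₁ ∷ x₂ ∷ μ ∷ []) ℚ-ring)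

    scaled-e₂ : ∀ x₀ x₁ x₂ μ ν a₄ {A₀ A₁ A₂ Γ} → A₀ ≡ x₀ * c₀ → A₁ ≡ x₁ * c₁ → A₂ ≡ x₂ * c₂ →
                Γ ≡ γ * γ → x₀ * x₁ + x₀ * x₂ + x₁ * x₂ ≡ a₄ - (1ℚ + 1ℚ) * μ * ν →
                A₁ * A₂ * c₀ + A₀ * A₂ * c₁ + A₀ * A₁ * c₂
                  ≡ - ((1ℚ + 1ℚ) * (γ * μ) * (γ * ν)) + a₄ * Γ
    scaled-e₂ x₀ x₁ x₂ μ ν a₄ refl refl refl refl e₂ = linear-combination
      ((c₀ * c₁ * c₂) ·ₕ e₂ +ₕ (a₄ - (1ℚ + 1ℚ) * μ * ν) ·ₕ c₀c₁c₂≡γ²)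
      (RingSolver.solve (c₀ ∷ c₁ ∷ c₂ ∷ γ ∷ x₀ ∷ x₁ ∷ x₂ ∷ μ ∷ ν ∷ a₄ ∷ []) ℚ-ring)

    scaled-e₃ : ∀ x₀ x₁ x₂ ν a₆ {A₀ A₁ A₂ Γ} → A₀ ≡ x₀ * c₀ → A₁ ≡ x₁ * c₁ → A₂ ≡ x₂ * c₂ →
                Γ ≡ γ * γ → x₀ * x₁ * x₂ ≡ ν * ν - a₆ →
                A₀ * A₁ * A₂ ≡ (γ * ν) * (γ * ν) - a₆ * Γ
    scaled-e₃ x₀ x₁ x₂ ν a₆ refl refl refl refl e₃ = linear-combination
      ((c₀ * c₁ * c₂) ·ₕ e₃ +ₕ (ν * ν - a₆) ·ₕ c₀c₁c₂≡γ²)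
      (RingSolver.solve (c₀ ∷ c₁ ∷ c₂ ∷ γ ∷ x₀ ∷ x₁ ∷ x₂ ∷ ν ∷ a₆ ∷ []) ℚ-ring)

  scaled-line : ∀ l il m n x y c c₃ γ γ′ {A B} → l * il ≡ 1ℚ → l * y ≡ m * x + n →
                A ≡ x * c → B ≡ y * c₃ → γ * c ≡ γ′ * c₃ →
                (γ * (m * il)) * A + (γ * (n * il)) * c ≡ γ′ * B
  scaled-line l il m n x y c c₃ γ γ′ l·il≡1 line refl refl γc≡γ′c₃ =
    linear-combination
      ((γ * c * il) ·ₕ sym line +ₕ (γ′ * c₃ * y) ·ₕ l·il≡1 +ₕ (y * l * il) ·ₕ γc≡γ′c₃)
      (RingSolver.solve (l ∷ il ∷ m ∷ n ∷ x ∷ y ∷ c ∷ c₃ ∷ γ ∷ γ′ ∷ []) ℚ-ring)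

module _ where
  open import Data.Integer using (_+_; _*_; _-_; -_)
  open ℤ-LinearCombination

  coprime-factors : ∀ {a b d x} → Coprime a b → d ∣ a * x → d ∣ b * x → d ∣ x
  coprime-factors {a} {b} {d} {x} a⊥b d∣ax d∣bx =
    ∣ᵤ⇒∣ (ℕ.coprime-factors {ℤ.∣ a ∣} {ℤ.∣ b ∣} {ℤ.∣ d ∣} {ℤ.∣ x ∣} a⊥b (unsigned a d∣ax , unsigned b d∣bx))
    where
    unsigned : ∀ c → d ∣ c * x → ℤ.∣ d ∣ ℕ.∣ ℤ.∣ c ∣ ℕ.* ℤ.∣ x ∣
    unsigned c d∣cx = subst (ℤ.∣ d ∣ ℕ.∣_) (ℤ.abs-* c x) (∣⇒∣ᵤ d∣cx)

  coprime-factors² : ∀ {a b d x} → Coprime a b → d ∣ a * x → d ∣ b * b * x → d ∣ x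
  coprime-factors² {a} {b} {d} {x} a⊥b d∣ax d∣bbx = coprime-factors {a} {b} a⊥b d∣ax d∣bx
    where
    b[ax]≡a[bx] : b * (a * x) ≡ a * (b * x)
    b[ax]≡a[bx] = solve (a ∷ b ∷ x ∷ [])
    d∣bx : d ∣ b * x
    d∣bx = coprime-factors {a} {b} a⊥b
      (subst (d ∣_) b[ax]≡a[bx] (∣n⇒∣m*n b d∣ax))
      (subst (d ∣_) (ℤ.*-assoc b b x) d∣bbx)

  module ScaledVietaConsequences (a₄ a₆ M N A₀ A₁ A₂ C₀ C₁ C₂ : ℤ)
    (e₁-eq : A₀ * (C₁ * C₁) * (C₂ * C₂) + A₁ * (C₀ * C₀) * (C₂ * C₂) + A₂ * (C₀ * C₀) * (C₁ * C₁)
             ≡ M * M)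
    (e₂-eq : A₁ * A₂ * (C₀ * C₀) + A₀ * A₂ * (C₁ * C₁) + A₀ * A₁ * (C₂ * C₂)
             ≡ - (+ 2 * M * N) + a₄ * (C₀ * C₁ * C₂ * (C₀ * C₁ * C₂)))
    (e₃-eq : A₀ * A₁ * A₂ ≡ N * N - a₆ * (C₀ * C₁ * C₂ * (C₀ * C₁ * C₂)))
    where

    shifted-e₁ : ∀ u v →
      (A₀ * v + C₀ * C₀ * u) * (C₁ * C₁) * (C₂ * C₂) + (A₁ * v + C₁ * C₁ * u) * (C₀ * C₀) * (C₂ * C₂)
        + (A₂ * v + C₂ * C₂ * u) * (C₀ * C₀) * (C₁ * C₁)
      ≡ M * M * v + + 3 * (C₀ * C₁ * C₂ * (C₀ * C₁ * C₂)) * u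
    shifted-e₁ u v = linear-combination (v ·ₕ e₁-eq)
      (solve (M ∷ A₀ ∷ A₁ ∷ A₂ ∷ C₀ ∷ C₁ ∷ C₂ ∷ u ∷ v ∷ []))

    shifted-e₂ : ∀ u v →
      (A₁ * v + C₁ * C₁ * u) * (A₂ * v + C₂ * C₂ * u) * (C₀ * C₀)
        + (A₀ * v + C₀ * C₀ * u) * (A₂ * v + C₂ * C₂ * u) * (C₁ * C₁)
        + (A₀ * v + C₀ * C₀ * u) * (A₁ * v + C₁ * C₁ * u) * (C₂ * C₂)
      ≡ - (+ 2 * M * (N * v - M * u) * v)
        + C₀ * C₁ * C₂ * (C₀ * C₁ * C₂) * (+ 3 * u * u + a₄ * v * v)
    shifted-e₂ u v = linear-combination ((v * v) ·ₕ e₂-eq +ₕ (+ 2 * u * v) ·ₕ e₁-eq)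
      (solve (a₄ ∷ M ∷ N ∷ A₀ ∷ A₁ ∷ A₂ ∷ C₀ ∷ C₁ ∷ C₂ ∷ u ∷ v ∷ []))

    shifted-e₃ : ∀ u v →
      (A₀ * v + C₀ * C₀ * u) * (A₁ * v + C₁ * C₁ * u) * (A₂ * v + C₂ * C₂ * u) * v
      ≡ (N * v - M * u) * (N * v - M * u) * (v * v)
        + C₀ * C₁ * C₂ * (C₀ * C₁ * C₂) * (v * (u * u * u + a₄ * u * v * v - a₆ * v * v * v))
    shifted-e₃ u v = linear-combination
      ((v * v * v * v) ·ₕ e₃-eq +ₕ (v * v * v * u) ·ₕ e₂-eq +ₕ (v * v * u * u) ·ₕ e₁-eq)
      (solve (a₄ ∷ a₆ ∷ M ∷ N ∷ A₀ ∷ A₁ ∷ A₂ ∷ C₀ ∷ C₁ ∷ C₂ ∷ u ∷ v ∷ []))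

    -- Each quantity X below has C₀ C₁ ∣ A₂ X and C₀ C₁ ∣ C₂² X; as A₂ is prime to C₂, C₀ C₁ ∣ X.
    module _ {B₂ : ℤ} (line₂ : M * A₂ + N * (C₂ * C₂) ≡ C₀ * C₁ * B₂) (A₂⊥C₂ : Coprime A₂ C₂) where

      C₀C₁∣MN+A₀A₁C₂² : C₀ * C₁ ∣ M * N + A₀ * A₁ * (C₂ * C₂)
      C₀C₁∣MN+A₀A₁C₂² = coprime-factors² {A₂} {C₂} A₂⊥C₂ A₂-multiple C₂²-multiple
        where
        A₂-multiple : C₀ * C₁ ∣ A₂ * (M * N + A₀ * A₁ * (C₂ * C₂))
        A₂-multiple = divides (N * B₂ - a₆ * (C₀ * C₁) * (C₂ * C₂) * (C₂ * C₂))
          (linear-combination (N ·ₕ line₂ +ₕ (C₂ * C₂) ·ₕ e₃-eq)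
            (solve (a₆ ∷ M ∷ N ∷ A₀ ∷ A₁ ∷ A₂ ∷ B₂ ∷ C₀ ∷ C₁ ∷ C₂ ∷ [])))
        C₂²-multiple : C₀ * C₁ ∣ C₂ * C₂ * (M * N + A₀ * A₁ * (C₂ * C₂))
        C₂²-multiple = divides (A₂ * A₂ * (C₀ * C₁) - M * B₂ + a₄ * (C₀ * C₁) * (C₂ * C₂) * (C₂ * C₂))
          (linear-combination ((C₂ * C₂) ·ₕ e₂-eq +ₕ (- A₂) ·ₕ e₁-eq +ₕ (- M) ·ₕ line₂)
            (solve (a₄ ∷ M ∷ N ∷ A₀ ∷ A₁ ∷ A₂ ∷ B₂ ∷ C₀ ∷ C₁ ∷ C₂ ∷ [])))

      C₀C₁∣A₀A₁M+A₀C₁²N+A₁C₀²N : C₀ * C₁ ∣ A₀ * A₁ * M + A₀ * (C₁ * C₁) * N + A₁ * (C₀ * C₀) * N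
      C₀C₁∣A₀A₁M+A₀C₁²N+A₁C₀²N = using-quotient C₀C₁∣MN+A₀A₁C₂²
        where
        using-quotient : C₀ * C₁ ∣ M * N + A₀ * A₁ * (C₂ * C₂) →
                         C₀ * C₁ ∣ A₀ * A₁ * M + A₀ * (C₁ * C₁) * N + A₁ * (C₀ * C₀) * N
        using-quotient (divides g G≡gC₀C₁) = coprime-factors² {A₂} {C₂} A₂⊥C₂ A₂-multiple C₂²-multiple
          where
          A₂-multiple : C₀ * C₁ ∣ A₂ * (A₀ * A₁ * M + A₀ * (C₁ * C₁) * N + A₁ * (C₀ * C₀) * N)
          A₂-multiple = divides (A₀ * A₁ * B₂ - + 2 * N * g + a₄ * N * (C₀ * C₁) * (C₂ * C₂))
            (linear-combination ((A₀ * A₁) ·ₕ line₂ +ₕ (- (+ 2 * N)) ·ₕ G≡gC₀C₁ +ₕ N ·ₕ e₂-eq)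
              (solve (a₄ ∷ M ∷ N ∷ A₀ ∷ A₁ ∷ A₂ ∷ B₂ ∷ C₀ ∷ C₁ ∷ C₂ ∷ g ∷ [])))
          C₂²-multiple : C₀ * C₁ ∣ C₂ * C₂ * (A₀ * A₁ * M + A₀ * (C₁ * C₁) * N + A₁ * (C₀ * C₀) * N)
          C₂²-multiple = divides (+ 2 * M * g - a₄ * M * (C₀ * C₁) * (C₂ * C₂)
                                   + B₂ * (A₀ * (C₁ * C₁) + A₁ * (C₀ * C₀)))
            (linear-combination
              ((+ 2 * M) ·ₕ G≡gC₀C₁ +ₕ (- M) ·ₕ e₂-eq +ₕ (A₀ * (C₁ * C₁) + A₁ * (C₀ * C₀)) ·ₕ line₂)
              (solve (a₄ ∷ M ∷ N ∷ A₀ ∷ A₁ ∷ A₂ ∷ B₂ ∷ C₀ ∷ C₁ ∷ C₂ ∷ g ∷ [])))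

ℚ-*-commutativeSemigroup : CommutativeSemigroup 0ℓ 0ℓ
ℚ-*-commutativeSemigroup = CommutativeMonoid.commutativeSemigroup ℚ.*-1-commutativeMonoid

module CollinearPoints
  (a₄ a₆ u v : ℤ) (A B C : Fin 3 → ℤ) (A⊥C : ∀ i → Coprime (A i) (C i))
  (x y : Fin 3 → ℚ)
  (A≡xC² : ∀ i → ↑ (A i) ≡ x i ℚ.* ↑ (C i ℤ.* C i))
  (B≡yC³ : ∀ i → ↑ (B i) ≡ y i ℚ.* ↑ (C i ℤ.* C i ℤ.* C i))
  (l m n : ℤ) (l≢0 : l ≢ + 0)
  (line : ∀ i → ↑ l ℚ.* y i ≡ ↑ m ℚ.* x i ℚ.+ ↑ n)
  (poly : ∀ X → ↑ l ℚ.* ↑ l ℚ.* (X ℚ.* X ℚ.* X ℚ.+ ↑ a₄ ℚ.* X ℚ.+ ↑ a₆)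
                  ℚ.- (↑ m ℚ.* X ℚ.+ ↑ n) ℚ.* (↑ m ℚ.* X ℚ.+ ↑ n)
                ≡ ↑ l ℚ.* ↑ l ℚ.* ((X ℚ.- x 0F) ℚ.* (X ℚ.- x 1F) ℚ.* (X ℚ.- x 2F)))
  where

  Cz : ℤ
  Cz = C 0F ℤ.* C 1F ℤ.* C 2F

  a : Fin 3 → ℤ
  a i = A i ℤ.* v ℤ.+ C i ℤ.* C i ℤ.* u

  c : Fin 3 → ℚ
  c i = ↑ (C i ℤ.* C i)

  il μ ν M N C² : ℚ
  il = inv (↑ l)
  μ  = ↑ m ℚ.* il
  ν  = ↑ n ℚ.* il
  M  = ↑ Cz ℚ.* μ
  N  = ↑ Cz ℚ.* ν
  C² = ↑ (Cz ℤ.* Cz)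

  l·il≡1 : ↑ l ℚ.* il ≡ ℚ.1ℚ
  l·il≡1 = trans (ℚ.*-comm (↑ l) il) (inv-inverseˡ (↑-≢0 l≢0))

  module Relations (i j k : Fin 3) (i≢j : i ≢ j) (j≢k : j ≢ k) (i≢k : i ≢ k) where

    Cz≡CᵢCⱼCₖ : Cz ≡ C i ℤ.* C j ℤ.* C k
    Cz≡CᵢCⱼCₖ = sym (∙-distinct-triple ℤ.*-commutativeSemigroup C i j k i≢j j≢k i≢k)

    roots : (x i ℚ.+ x j ℚ.+ x k ≡ μ ℚ.* μ)
            × (x i ℚ.* x j ℚ.+ x i ℚ.* x k ℚ.+ x j ℚ.* x k ≡ ↑ a₄ ℚ.- (ℚ.1ℚ ℚ.+ ℚ.1ℚ) ℚ.* μ ℚ.* ν)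
            × (x i ℚ.* x j ℚ.* x k ≡ ν ℚ.* ν ℚ.- ↑ a₆)
    roots = vieta (↑ l) il (↑ m) (↑ n) (↑ a₄) (↑ a₆) (x i) (x j) (x k) l·il≡1 λ X →
      trans (poly X) (cong (↑ l ℚ.* ↑ l ℚ.*_)
        (sym (∙-distinct-triple ℚ-*-commutativeSemigroup (λ t → X ℚ.- x t) i j k i≢j j≢k i≢k)))

    cᵢcⱼcₖ≡Cz² : c i ℚ.* c j ℚ.* c k ≡ ↑ Cz ℚ.* ↑ Cz
    cᵢcⱼcₖ≡Cz² = value-≡⇒≡ (integral (C i ℤ.* C i) ⊛ integral (C j ℤ.* C j) ⊛ integral (C k ℤ.* C k))
                           (integral Cz ⊛ integral Cz)
                           (trans (squares (C i) (C j) (C k)) (cong₂ ℤ._*_ (sym Cz≡CᵢCⱼCₖ) (sym Cz≡CᵢCⱼCₖ)))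
      where
      squares : ∀ p q r → p ℤ.* p ℤ.* (q ℤ.* q) ℤ.* (r ℤ.* r) ≡ p ℤ.* q ℤ.* r ℤ.* (p ℤ.* q ℤ.* r)
      squares = solve-∀

    open ScaledVieta {c i} {c j} {c k} {↑ Cz} cᵢcⱼcₖ≡Cz²

    e₁-eq : ↑ (A i) ℚ.* c j ℚ.* c k ℚ.+ ↑ (A j) ℚ.* c i ℚ.* c k ℚ.+ ↑ (A k) ℚ.* c i ℚ.* c j ≡ M ℚ.* M
    e₁-eq = scaled-e₁ (x i) (x j) (x k) μ (A≡xC² i) (A≡xC² j) (A≡xC² k) (proj₁ roots)

    e₂-eq : ↑ (A j) ℚ.* ↑ (A k) ℚ.* c i ℚ.+ ↑ (A i) ℚ.* ↑ (A k) ℚ.* c j ℚ.+ ↑ (A i) ℚ.* ↑ (A j) ℚ.* c k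
            ≡ ℚ.- (↑ (+ 2) ℚ.* M ℚ.* N) ℚ.+ ↑ a₄ ℚ.* C²
    e₂-eq = scaled-e₂ (x i) (x j) (x k) μ ν (↑ a₄) (A≡xC² i) (A≡xC² j) (A≡xC² k) (↑-* Cz Cz)
                      (proj₁ (proj₂ roots))

    e₃-eq : ↑ (A i) ℚ.* ↑ (A j) ℚ.* ↑ (A k) ≡ N ℚ.* N ℚ.- ↑ a₆ ℚ.* C²
    e₃-eq = scaled-e₃ (x i) (x j) (x k) ν (↑ a₆) (A≡xC² i) (A≡xC² j) (A≡xC² k) (↑-* Cz Cz)
                      (proj₂ (proj₂ roots))

    line-eq : M ℚ.* ↑ (A k) ℚ.+ N ℚ.* c k ≡ ↑ (C i ℤ.* C j) ℚ.* ↑ (B k)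
    line-eq = scaled-line (↑ l) il (↑ m) (↑ n) (x k) (y k) (c k) (↑ (C k ℤ.* C k ℤ.* C k))
                          (↑ Cz) (↑ (C i ℤ.* C j)) l·il≡1 (line k) (A≡xC² k) (B≡yC³ k)
      (value-≡⇒≡ (integral Cz ⊛ integral (C k ℤ.* C k))
                 (integral (C i ℤ.* C j) ⊛ integral (C k ℤ.* C k ℤ.* C k))
                 (trans (cong (ℤ._* (C k ℤ.* C k)) Cz≡CᵢCⱼCₖ) (cofactor (C i) (C j) (C k))))
      where
      cofactor : ∀ p q r → p ℤ.* q ℤ.* r ℤ.* (r ℤ.* r) ≡ p ℤ.* q ℤ.* (r ℤ.* r ℤ.* r)
      cofactor = solve-∀

  module Base = Relations 0F 1F 2F (λ ()) (λ ()) (λ ())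

  integral-M : Integral M
  integral-M = square-integral⇒integral
    (integral (A 0F) ⊛ integral (C 1F ℤ.* C 1F) ⊛ integral (C 2F ℤ.* C 2F)
     ⊕ integral (A 1F) ⊛ integral (C 0F ℤ.* C 0F) ⊛ integral (C 2F ℤ.* C 2F)
     ⊕ integral (A 2F) ⊛ integral (C 0F ℤ.* C 0F) ⊛ integral (C 1F ℤ.* C 1F))
    (sym Base.e₁-eq)

  integral-N : Integral N
  integral-N = square-integral⇒integral
    (integral (A 0F) ⊛ integral (A 1F) ⊛ integral (A 2F) ⊕ integral a₆ ⊛ integral (Cz ℤ.* Cz))
    (x≡y-z⇒y≡x+z (N ℚ.* N) (↑ a₆ ℚ.* C²) Base.e₃-eq)

  M′ N′ : ℤ
  M′ = value integral-M
  N′ = value integral-N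

  module IntegerRelations (i j k : Fin 3) (i≢j : i ≢ j) (j≢k : j ≢ k) (i≢k : i ≢ k) where
    open Relations i j k i≢j j≢k i≢k

    integral-C² : Integral C²
    integral-C² = record
      { value  = C i ℤ.* C j ℤ.* C k ℤ.* (C i ℤ.* C j ℤ.* C k)
      ; ↑value = cong ↑ (cong₂ ℤ._*_ (sym Cz≡CᵢCⱼCₖ) (sym Cz≡CᵢCⱼCₖ)) }

    open ScaledVietaConsequences a₄ a₆ M′ N′ (A i) (A j) (A k) (C i) (C j) (C k)
      (≡⇒value-≡ (integral (A i) ⊛ integral (C j ℤ.* C j) ⊛ integral (C k ℤ.* C k)
                  ⊕ integral (A j) ⊛ integral (C i ℤ.* C i) ⊛ integral (C k ℤ.* C k)
                  ⊕ integral (A k) ⊛ integral (C i ℤ.* C i) ⊛ integral (C j ℤ.* C j))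
                 (integral-M ⊛ integral-M) e₁-eq)
      (≡⇒value-≡ (integral (A j) ⊛ integral (A k) ⊛ integral (C i ℤ.* C i)
                  ⊕ integral (A i) ⊛ integral (A k) ⊛ integral (C j ℤ.* C j)
                  ⊕ integral (A i) ⊛ integral (A j) ⊛ integral (C k ℤ.* C k))
                 (⊝ (integral (+ 2) ⊛ integral-M ⊛ integral-N) ⊕ integral a₄ ⊛ integral-C²) e₂-eq)
      (≡⇒value-≡ (integral (A i) ⊛ integral (A j) ⊛ integral (A k))
                 (integral-N ⊛ integral-N ⊖ integral a₆ ⊛ integral-C²) e₃-eq)
      public

    line-ℤ : M′ ℤ.* A k ℤ.+ N′ ℤ.* (C k ℤ.* C k) ≡ C i ℤ.* C j ℤ.* B k
    line-ℤ = ≡⇒value-≡ (integral-M ⊛ integral (A k) ⊕ integral-N ⊛ integral (C k ℤ.* C k))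
                       (integral (C i ℤ.* C j) ⊛ integral (B k)) line-eq

    divisibility : (C i ℤ.* C j) ∣ℚ (M ℚ.* N ℚ.+ ↑ (A i ℤ.* A j ℤ.* (C k ℤ.* C k)))
                   × (C i ℤ.* C j) ∣ℚ (↑ (A i ℤ.* A j) ℚ.* M
                                        ℚ.+ ↑ (A i ℤ.* (C j ℤ.* C j)) ℚ.* N
                                        ℚ.+ ↑ (A j ℤ.* (C i ℤ.* C i)) ℚ.* N)
    divisibility =
      ∣value⇒∣ℚ (integral-M ⊛ integral-N ⊕ integral (A i ℤ.* A j ℤ.* (C k ℤ.* C k)))
                (C₀C₁∣MN+A₀A₁C₂² line-ℤ (A⊥C k)) ,
      ∣value⇒∣ℚ (integral (A i ℤ.* A j) ⊛ integral-M ⊕ integral (A i ℤ.* (C j ℤ.* C j)) ⊛ integral-N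
                 ⊕ integral (A j ℤ.* (C i ℤ.* C i)) ⊛ integral-N)
                (C₀C₁∣A₀A₁M+A₀C₁²N+A₁C₀²N line-ℤ (A⊥C k))

  module BaseIntegral = IntegerRelations 0F 1F 2F (λ ()) (λ ()) (λ ())

  b : ℚ
  b = N ℚ.* ↑ v ℚ.- M ℚ.* ↑ u

  integral-b : Integral b
  integral-b = integral-N ⊛ integral v ⊖ integral-M ⊛ integral u

  identity₁ : ↑ (a 0F) ℚ.* ↑ (a 1F) ℚ.* ↑ (a 2F) ℚ.* ↑ v
              ≡ b ℚ.* b ℚ.* ↑ (v ℤ.* v) ℚ.+ C² ℚ.* ↑ (dE a₄ a₆ u v)
  identity₁ = value-≡⇒≡
    (integral (a 0F) ⊛ integral (a 1F) ⊛ integral (a 2F) ⊛ integral v)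
    (integral-b ⊛ integral-b ⊛ integral (v ℤ.* v) ⊕ integral (Cz ℤ.* Cz) ⊛ integral (dE a₄ a₆ u v))
    (BaseIntegral.shifted-e₃ u v)

  identity₃ : ↑ (a 1F) ℚ.* ↑ (a 2F) ℚ.* c 0F ℚ.+ ↑ (a 0F) ℚ.* ↑ (a 2F) ℚ.* c 1F
                ℚ.+ ↑ (a 0F) ℚ.* ↑ (a 1F) ℚ.* c 2F
              ≡ ℚ.- (↑ (+ 2) ℚ.* M ℚ.* b ℚ.* ↑ v) ℚ.+ C² ℚ.* ↑ (+ 3 ℤ.* u ℤ.* u ℤ.+ a₄ ℤ.* v ℤ.* v)
  identity₃ = value-≡⇒≡
    (integral (a 1F) ⊛ integral (a 2F) ⊛ integral (C 0F ℤ.* C 0F)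
     ⊕ integral (a 0F) ⊛ integral (a 2F) ⊛ integral (C 1F ℤ.* C 1F)
     ⊕ integral (a 0F) ⊛ integral (a 1F) ⊛ integral (C 2F ℤ.* C 2F))
    (⊝ (integral (+ 2) ⊛ integral-M ⊛ integral-b ⊛ integral v)
     ⊕ integral (Cz ℤ.* Cz) ⊛ integral (+ 3 ℤ.* u ℤ.* u ℤ.+ a₄ ℤ.* v ℤ.* v))
    (BaseIntegral.shifted-e₂ u v)

  identity₅ : ↑ (a 0F) ℚ.* c 1F ℚ.* c 2F ℚ.+ ↑ (a 1F) ℚ.* c 0F ℚ.* c 2F ℚ.+ ↑ (a 2F) ℚ.* c 0F ℚ.* c 1F
              ≡ M ℚ.* M ℚ.* ↑ v ℚ.+ ↑ (+ 3) ℚ.* C² ℚ.* ↑ u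
  identity₅ = value-≡⇒≡
    (integral (a 0F) ⊛ integral (C 1F ℤ.* C 1F) ⊛ integral (C 2F ℤ.* C 2F)
     ⊕ integral (a 1F) ⊛ integral (C 0F ℤ.* C 0F) ⊛ integral (C 2F ℤ.* C 2F)
     ⊕ integral (a 2F) ⊛ integral (C 0F ℤ.* C 0F) ⊛ integral (C 1F ℤ.* C 1F))
    (integral-M ⊛ integral-M ⊛ integral v ⊕ integral (+ 3) ⊛ integral (Cz ℤ.* Cz) ⊛ integral u)
    (BaseIntegral.shifted-e₁ u v)

lemma2p5 :
  (a4 a6 : ℤ) → Nonsingular a4 a6 →
  (u v : ℤ) → + 0 ℤ.< u → + 0 ℤ.< v →
  + 0 ℤ.< (+ 3) ℤ.* u ℤ.* u ℤ.+ a4 ℤ.* v ℤ.* v →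
  + 0 ℤ.< DE a4 a6 u v →
  FundamentalDiscriminant (ℤ.- DE a4 a6 u v) →
  (A B C : Fin 3 → ℤ) →
  (∀ i → gcd (A i) (C i) ≡ + 1) →
  (∀ i → gcd (B i) (C i) ≡ + 1) →
  (∀ i → + 0 ℤ.< C i) →
  let x : Fin 3 → ℚ
      x i = ↑ (A i) ℚ.* inv (↑ (C i ℤ.* C i))
      y : Fin 3 → ℚ
      y i = ↑ (B i) ℚ.* inv (↑ (C i ℤ.* C i ℤ.* C i))
      P : Fin 3 → Pt
      P i = pt (x i) (y i)
  in
  (∀ i → OnCurve a4 a6 (x i) (y i)) →
  addE a4 (addE a4 (P (# 0)) (P (# 1))) (P (# 2)) ≡ O →
  (l m n : ℤ) → l ≢ + 0 →
  (∀ i → ↑ l ℚ.* y i ≡ ↑ m ℚ.* x i ℚ.+ ↑ n) →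
  (∀ (X : ℚ) →
    ↑ l ℚ.* ↑ l ℚ.* (X ℚ.* X ℚ.* X ℚ.+ ↑ a4 ℚ.* X ℚ.+ ↑ a6)
      ℚ.- (↑ m ℚ.* X ℚ.+ ↑ n) ℚ.* (↑ m ℚ.* X ℚ.+ ↑ n)
    ≡ ↑ l ℚ.* ↑ l ℚ.* ((X ℚ.- x (# 0)) ℚ.* (X ℚ.- x (# 1)) ℚ.* (X ℚ.- x (# 2)))) →
  let Cz : ℤ
      Cz = C (# 0) ℤ.* C (# 1) ℤ.* C (# 2)
      M : ℚ
      M = ↑ Cz ℚ.* (↑ m ℚ.* inv (↑ l))
      N : ℚ
      N = ↑ Cz ℚ.* (↑ n ℚ.* inv (↑ l))
      b : ℚ
      b = N ℚ.* ↑ v ℚ.- M ℚ.* ↑ u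
      a : Fin 3 → ℤ
      a i = A i ℤ.* v ℤ.+ C i ℤ.* C i ℤ.* u
      d : ℤ
      d = dE a4 a6 u v
      C² : ℚ
      C² = ↑ (Cz ℤ.* Cz)
      a₁ = ↑ (a (# 0))
      a₂ = ↑ (a (# 1))
      a₃ = ↑ (a (# 2))
      A₁ = ↑ (A (# 0))
      A₂ = ↑ (A (# 1))
      A₃ = ↑ (A (# 2))
      C₁² = ↑ (C (# 0) ℤ.* C (# 0))
      C₂² = ↑ (C (# 1) ℤ.* C (# 1))
      C₃² = ↑ (C (# 2) ℤ.* C (# 2))
  in
  (a₁ ℚ.* a₂ ℚ.* a₃ ℚ.* ↑ v ≡ b ℚ.* b ℚ.* ↑ (v ℤ.* v) ℚ.+ C² ℚ.* ↑ d)
  × (A₁ ℚ.* A₂ ℚ.* A₃ ≡ N ℚ.* N ℚ.- ↑ a6 ℚ.* C²)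
  × (a₂ ℚ.* a₃ ℚ.* C₁² ℚ.+ a₁ ℚ.* a₃ ℚ.* C₂² ℚ.+ a₁ ℚ.* a₂ ℚ.* C₃²
      ≡ ℚ.- (↑ (+ 2) ℚ.* M ℚ.* b ℚ.* ↑ v)
        ℚ.+ C² ℚ.* ↑ ((+ 3) ℤ.* u ℤ.* u ℤ.+ a4 ℤ.* v ℤ.* v))
  × (A₂ ℚ.* A₃ ℚ.* C₁² ℚ.+ A₁ ℚ.* A₃ ℚ.* C₂² ℚ.+ A₁ ℚ.* A₂ ℚ.* C₃²
      ≡ ℚ.- (↑ (+ 2) ℚ.* M ℚ.* N) ℚ.+ ↑ a4 ℚ.* C²)
  × (a₁ ℚ.* C₂² ℚ.* C₃² ℚ.+ a₂ ℚ.* C₁² ℚ.* C₃² ℚ.+ a₃ ℚ.* C₁² ℚ.* C₂²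
      ≡ M ℚ.* M ℚ.* ↑ v ℚ.+ ↑ (+ 3) ℚ.* C² ℚ.* ↑ u)
  × (A₁ ℚ.* C₂² ℚ.* C₃² ℚ.+ A₂ ℚ.* C₁² ℚ.* C₃² ℚ.+ A₃ ℚ.* C₁² ℚ.* C₂²
      ≡ M ℚ.* M)
  × (∀ (i j k : Fin 3) → i ≢ j → j ≢ k → i ≢ k →
      ((C i ℤ.* C j) ∣ℚ (M ℚ.* N ℚ.+ ↑ (A i ℤ.* A j ℤ.* (C k ℤ.* C k))))
      × ((C i ℤ.* C j) ∣ℚ (↑ (A i ℤ.* A j) ℚ.* M
                            ℚ.+ ↑ (A i ℤ.* (C j ℤ.* C j)) ℚ.* N
                            ℚ.+ ↑ (A j ℤ.* (C i ℤ.* C i)) ℚ.* N)))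
lemma2p5 a4 a6 _ u v _ _ _ _ _ A B C gcd[A,C]≡1 _ C>0 _ _ l m n l≢0 line poly =
  identity₁ , Base.e₃-eq , identity₃ , Base.e₂-eq , identity₅ , Base.e₁-eq ,
  IntegerRelations.divisibility
  where
  C≢0 : ∀ i → C i ≢ + 0
  C≢0 i = ≢-sym (ℤ.<⇒≢ (C>0 i))

  product≢0 : ∀ {p q} → p ≢ + 0 → q ≢ + 0 → p ℤ.* q ≢ + 0
  product≢0 {p} p≢0 q≢0 pq≡0 = [ p≢0 , q≢0 ]′ (ℤ.i*j≡0⇒i≡0∨j≡0 p pq≡0)

  x y : Fin 3 → ℚ
  x i = ↑ (A i) ℚ.* inv (↑ (C i ℤ.* C i))
  y i = ↑ (B i) ℚ.* inv (↑ (C i ℤ.* C i ℤ.* C i))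

  open CollinearPoints a4 a6 u v A B C
    (λ i → ℕ.gcd≡1⇒coprime (ℤ.+-injective (gcd[A,C]≡1 i))) x y
    (λ i → sym (inv-cancelʳ (↑-≢0 (product≢0 (C≢0 i) (C≢0 i)))))
    (λ i → sym (inv-cancelʳ (↑-≢0 (product≢0 (product≢0 (C≢0 i) (C≢0 i)) (C≢0 i)))))
    l m n l≢0 line poly
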